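{- For every integer $k\ge 2$, \[ c_{k+1}=\sum_{i=1}^{k-1}\binom{2(k-i+1)}{k+1-i}\gamma_i-\sum_{i=1}^{k-1}\binom{2(k-i)}{k+1-i}\gamma_i-\sum_{i=1}^{k-2}2\binom{2(k-i-1)}{k-i}\gamma_i, \] where $c_m=\frac{1}{m+1}\binom{2m}{m}$ is the $m$-th Catalan number, $\gamma_1=1$, and for $2\le i\le k$, $\gamma_i=-\sum_{j=1}^{i-2}\binom{2(i-j-1)}{i-j}\gamma_j$.
   Context: An empty sum $\sum_{i=a}^{b}$ with $a>b$ is $0$; $\binom{a}{b}=0$ for integers $0\le a<b$. -}

module Defs where

open import Data.Nat.Base using (ℕ; zero; suc; _+_; _*_; _∸_; _/_)
open import Data.Nat.Combinatorics using (_C_)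
open import Data.Integer.Base as ℤ using (ℤ)
open import Data.List.Base using (List; foldr; map; applyUpTo)

-- ∑_{i=a}^{b} f i over ℤ (inclusive); empty (= 0) when a > b.
∑[_to_] : ℕ → ℕ → (ℕ → ℤ) → ℤ
∑[ a to b ] f = foldr ℤ._+_ (ℤ.+ 0) (map f (applyUpTo (a +_) (suc b ∸ a)))

-- binomial coefficient as an integer (stdlib: n C k = 0 when k > n)
binom : ℕ → ℕ → ℤ
binom n k = ℤ.+ (n C k)

catalan : ℕ → ℕ
catalan m = ((2 * m) C m) / suc m

-- Work with power series over ℤ and let C be the Catalan series, so that
-- 1 - 2xC = √(1-4x).  The numbers E r n = binom(r+2n, n) form the series C^r/√(1-4x),
-- so E r·(1 - 2xC) is the series C^r, whose coefficients are the ballot numbers; hence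
-- ballot s ⋆ E r = E (r+s).  Writing Γ j = γ (j+1), the recursion for γ says
-- Γ·(1 + x²E₂) = 1 up to degree k - 1, and Γ = 1 - x²C⁴ solves it since
-- Γ·E₂ = E₂ - x²E₆ = C⁴.  The three sums are coefficients of Γ·E₀ and Γ·xE₂, and
-- Γ·E₀ = E₀ - x²E₄ = C² = (C - 1)/x has the Catalan numbers c_{k+1} as coefficients.
module Submission where

open import Defs
open import Data.Nat.Base using (ℕ; zero; suc; z≤n; s≤s; s≤s⁻¹; _∸_; _≤_; _<_; _/_)
  renaming (_+_ to _+ℕ_; _*_ to _*ℕ_)
import Data.Nat.Properties as ℕ
open import Data.Nat.Combinatorics using (_C_; nCk+nC[k+1]≡[n+1]C[k+1]; nCk≡nC[n∸k]; nC1≡n)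
open import Data.Nat.DivMod using (m*n/n≡m)
import Data.Nat.Tactic.RingSolver as ℕ-Solver
open import Data.Integer.Base using (ℤ; +_; _+_; _-_; -_; _*_; _⊖_)
import Data.Integer.Properties as ℤ
import Data.Integer.Tactic.RingSolver as ℤ-Solver
open import Algebra.Properties.CommutativeSemigroup ℤ.+-commutativeSemigroup
  using () renaming (interchange to +-interchange)
open import Algebra.Properties.CommutativeSemigroup ℤ.*-commutativeSemigroup
  using (x∙yz≈y∙xz)
open import Data.List.Base using (foldr; map; applyUpTo)
open import Data.Sum.Base using (inj₁; inj₂)
open import Function.Base using (_∘_)
open import Relation.Binary.PropositionalEquality
  using (_≡_; refl; sym; trans; cong; cong₂; module ≡-Reasoning)

∑[<_]_ : ℕ → (ℕ → ℤ) → ℤ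
∑[< zero  ] u = + 0
∑[< suc n ] u = u 0 + ∑[< n ] (u ∘ suc)

foldr-+-applyUpTo : ∀ (f : ℕ → ℤ) h n →
  foldr _+_ (+ 0) (map f (applyUpTo h n)) ≡ ∑[< n ] (f ∘ h)
foldr-+-applyUpTo f h zero    = refl
foldr-+-applyUpTo f h (suc n) = cong (_+_ (f (h 0))) (foldr-+-applyUpTo f (h ∘ suc) n)

∑[1to]≡∑[<] : ∀ b f → ∑[ 1 to b ] f ≡ ∑[< b ] (f ∘ suc)
∑[1to]≡∑[<] b f = foldr-+-applyUpTo f suc b

∑[<]-cong : ∀ {u v} n → (∀ i → i < n → u i ≡ v i) → ∑[< n ] u ≡ ∑[< n ] v
∑[<]-cong zero    eq = refl
∑[<]-cong (suc n) eq = cong₂ _+_ (eq 0 (s≤s z≤n)) (∑[<]-cong n (λ i i<n → eq (suc i) (s≤s i<n)))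

∑[<]-snoc : ∀ n u → ∑[< suc n ] u ≡ ∑[< n ] u + u n
∑[<]-snoc zero    u = ℤ.+-comm (u 0) (+ 0)
∑[<]-snoc (suc n) u = trans (cong (_+_ (u 0)) (∑[<]-snoc n (u ∘ suc))) (sym (ℤ.+-assoc (u 0) _ _))

∑[<]-+ : ∀ n u v → ∑[< n ] (λ i → u i + v i) ≡ ∑[< n ] u + ∑[< n ] v
∑[<]-+ zero    u v = refl
∑[<]-+ (suc n) u v = trans (cong (_+_ (u 0 + v 0)) (∑[<]-+ n (u ∘ suc) (v ∘ suc)))
  (+-interchange (u 0) (v 0) _ _)

∑[<]-*ˡ : ∀ n c u → ∑[< n ] (λ i → c * u i) ≡ c * ∑[< n ] u
∑[<]-*ˡ zero    c u = sym (ℤ.*-zeroʳ c)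
∑[<]-*ˡ (suc n) c u = trans (cong (_+_ (c * u 0)) (∑[<]-*ˡ n c (u ∘ suc)))
  (sym (ℤ.*-distribˡ-+ c (u 0) _))

∑[1to]-*ˡ : ∀ b c (u v : ℕ → ℤ) →
  ∑[ 1 to b ] (λ i → c * u i * v i) ≡ c * ∑[ 1 to b ] (λ i → u i * v i)
∑[1to]-*ˡ b c u v = begin
    ∑[ 1 to b ] (λ i → c * u i * v i)
  ≡⟨ ∑[1to]≡∑[<] b (λ i → c * u i * v i) ⟩
    ∑[< b ] (λ i → c * u (suc i) * v (suc i))
  ≡⟨ ∑[<]-cong b (λ i _ → ℤ.*-assoc c (u (suc i)) (v (suc i))) ⟩
    ∑[< b ] (λ i → c * (u (suc i) * v (suc i)))
  ≡⟨ ∑[<]-*ˡ b c (λ i → u (suc i) * v (suc i)) ⟩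
    c * ∑[< b ] (λ i → u (suc i) * v (suc i))
  ≡⟨ cong (c *_) (∑[1to]≡∑[<] b (λ i → u i * v i)) ⟨
    c * ∑[ 1 to b ] (λ i → u i * v i)
  ∎
  where open ≡-Reasoning

infixl 7 _⋆_

_⋆_ : (ℕ → ℤ) → (ℕ → ℤ) → ℕ → ℤ
(f ⋆ g) n = ∑[< suc n ] (λ i → f i * g (n ∸ i))

x∙_ : (ℕ → ℤ) → ℕ → ℤ
(x∙ h) zero    = + 0
(x∙ h) (suc m) = h m

δ : ℕ → ℤ
δ zero    = + 1
δ (suc _) = + 0

⋆-congˡ : ∀ {f g} h n → (∀ i → i < suc n → f i ≡ g i) → (f ⋆ h) n ≡ (g ⋆ h) n
⋆-congˡ h n eq = ∑[<]-cong (suc n) (λ i i<1+n → cong (_* h (n ∸ i)) (eq i i<1+n))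

⋆-congʳ : ∀ f {g h} n → (∀ m → g m ≡ h m) → (f ⋆ g) n ≡ (f ⋆ h) n
⋆-congʳ f n eq = ∑[<]-cong (suc n) (λ i _ → cong (f i *_) (eq (n ∸ i)))

⋆-distribˡ-+ : ∀ f g h n → (f ⋆ (λ m → g m + h m)) n ≡ (f ⋆ g) n + (f ⋆ h) n
⋆-distribˡ-+ f g h n =
  trans (∑[<]-cong (suc n) (λ i _ → ℤ.*-distribˡ-+ (f i) (g (n ∸ i)) (h (n ∸ i))))
        (∑[<]-+ (suc n) (λ i → f i * g (n ∸ i)) (λ i → f i * h (n ∸ i)))

⋆-scaleʳ : ∀ c f g n → (f ⋆ (λ m → c * g m)) n ≡ c * (f ⋆ g) n
⋆-scaleʳ c f g n =
  trans (∑[<]-cong (suc n) (λ i _ → x∙yz≈y∙xz (f i) c (g (n ∸ i))))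
        (∑[<]-*ˡ (suc n) c (λ i → f i * g (n ∸ i)))

⋆-negˡ : ∀ f g n → ((λ i → - f i) ⋆ g) n ≡ - (f ⋆ g) n
⋆-negˡ f g n =
  trans (∑[<]-cong {v = λ i → - + 1 * (f i * g (n ∸ i))} (suc n)
                   (λ i _ → trans (sym (ℤ.neg-distribˡ-* (f i) _)) (sym (ℤ.-1*i≡-i _))))
        (trans (∑[<]-*ˡ (suc n) (- + 1) (λ i → f i * g (n ∸ i))) (ℤ.-1*i≡-i _))

⋆-identityʳ : ∀ f n → (f ⋆ δ) n ≡ f n
⋆-identityʳ f zero    = trans (ℤ.+-identityʳ _) (ℤ.*-identityʳ (f 0))
⋆-identityʳ f (suc n) = trans (cong (_+ (f ∘ suc ⋆ δ) n) (ℤ.*-zeroʳ (f 0)))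
  (trans (ℤ.+-identityˡ _) (⋆-identityʳ (f ∘ suc) n))

⋆-snoc : ∀ f g n → (f ⋆ g) (suc n) ≡ (f ⋆ (g ∘ suc)) n + f (suc n) * g 0
⋆-snoc f g n = begin
    (f ⋆ g) (suc n)
  ≡⟨ ∑[<]-snoc (suc n) (λ i → f i * g (suc n ∸ i)) ⟩
    ∑[< suc n ] (λ i → f i * g (suc n ∸ i)) + f (suc n) * g (n ∸ n)
  ≡⟨ cong₂ _+_ (∑[<]-cong (suc n) (λ i i<1+n →
                  cong (λ m → f i * g m) (ℕ.+-∸-assoc 1 (s≤s⁻¹ i<1+n))))
               (cong (λ m → f (suc n) * g m) (ℕ.n∸n≡0 n)) ⟩
    (f ⋆ (g ∘ suc)) n + f (suc n) * g 0
  ∎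
  where open ≡-Reasoning

⋆-x∙ : ∀ f h n → (f ⋆ x∙ h) (suc n) ≡ (f ⋆ h) n
⋆-x∙ f h n = trans (⋆-snoc f (x∙ h) n)
  (trans (cong (_+_ ((f ⋆ h) n)) (ℤ.*-zeroʳ (f (suc n)))) (ℤ.+-identityʳ _))

E : ℕ → ℕ → ℤ
E r n = binom (r +ℕ 2 *ℕ n) n

r+2[1+n]≡2+r+2n : ∀ r n → r +ℕ 2 *ℕ suc n ≡ suc (suc (r +ℕ 2 *ℕ n))
r+2[1+n]≡2+r+2n = ℕ-Solver.solve-∀

C-sym : ∀ {n} a b → a +ℕ b ≡ n → n C a ≡ n C b
C-sym a b refl = trans (nCk≡nC[n∸k] (ℕ.m≤m+n a b)) (cong ((a +ℕ b) C_) (ℕ.m+n∸m≡n a b))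

E-pascal : ∀ r m → E (suc r) m ≡ E r m + (x∙ E (suc (suc r))) m
E-pascal r zero    = refl
E-pascal r (suc n) = trans (cong +_ (begin
    suc (r +ℕ 2 *ℕ suc n) C suc n
  ≡⟨ cong (λ x → suc x C suc n) (r+2[1+n]≡2+r+2n r n) ⟩
    suc N C suc n
  ≡⟨ nCk+nC[k+1]≡[n+1]C[k+1] N n ⟨
    N C n +ℕ N C suc n
  ≡⟨ ℕ.+-comm (N C n) _ ⟩
    N C suc n +ℕ N C n
  ≡⟨ cong (λ x → x C suc n +ℕ N C n) (r+2[1+n]≡2+r+2n r n) ⟨
    (r +ℕ 2 *ℕ suc n) C suc n +ℕ N C n
  ∎)) (ℤ.pos-+ ((r +ℕ 2 *ℕ suc n) C suc n) (N C n))
  where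
  open ≡-Reasoning
  N = suc (suc (r +ℕ 2 *ℕ n))

E₀-suc : ∀ n → E 0 (suc n) ≡ + 2 * E 1 n
E₀-suc n = trans (cong +_ (begin
    2 *ℕ suc n C suc n
  ≡⟨ cong (_C suc n) (r+2[1+n]≡2+r+2n 0 n) ⟩
    suc M C suc n
  ≡⟨ nCk+nC[k+1]≡[n+1]C[k+1] M n ⟨
    M C n +ℕ M C suc n
  ≡⟨ cong (M C n +ℕ_) (C-sym (suc n) n (1+n+n≡1+2n n)) ⟩
    M C n +ℕ M C n
  ≡⟨ cong (M C n +ℕ_) (ℕ.+-identityʳ (M C n)) ⟨
    2 *ℕ (M C n)
  ∎)) (ℤ.pos-* 2 (M C n))
  where
  open ≡-Reasoning
  M = suc (2 *ℕ n)
  1+n+n≡1+2n : ∀ n → suc n +ℕ n ≡ suc (2 *ℕ n)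
  1+n+n≡1+2n = ℕ-Solver.solve-∀

E₀≡δ+x∙2E₁ : ∀ m → E 0 m ≡ δ m + (x∙ (λ n → + 2 * E 1 n)) m
E₀≡δ+x∙2E₁ zero    = refl
E₀≡δ+x∙2E₁ (suc n) = trans (E₀-suc n) (sym (ℤ.+-identityˡ _))

-- κ (i - j - 1) is the coefficient of γ j in the recursion for γ i.
κ : ℕ → ℤ
κ m = binom (2 *ℕ m) (suc m)

κ≡x∙E₂ : ∀ m → κ m ≡ (x∙ E 2) m
κ≡x∙E₂ zero    = refl
κ≡x∙E₂ (suc m) = cong +_
  (trans (cong (_C suc (suc m)) (r+2[1+n]≡2+r+2n 0 m)) (C-sym (suc (suc m)) m (2+m+m≡2+2m m)))
  where
  2+m+m≡2+2m : ∀ m → suc (suc m) +ℕ m ≡ suc (suc (2 *ℕ m))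
  2+m+m≡2+2m = ℕ-Solver.solve-∀

ballot : ℕ → ℕ → ℤ
ballot s zero    = + 1
ballot s (suc n) = E s (suc n) - + 2 * E (suc s) n

ballot⋆E : ∀ s r n → (ballot s ⋆ E r) n ≡ E (r +ℕ s) n
ballot⋆E s r       zero    = refl
ballot⋆E s (suc r) (suc n) = begin
    (ballot s ⋆ E (suc r)) (suc n)
  ≡⟨ ⋆-congʳ (ballot s) (suc n) (E-pascal r) ⟩
    (ballot s ⋆ (λ m → E r m + (x∙ E (suc (suc r))) m)) (suc n)
  ≡⟨ ⋆-distribˡ-+ (ballot s) (E r) (x∙ E (suc (suc r))) (suc n) ⟩
    (ballot s ⋆ E r) (suc n) + (ballot s ⋆ x∙ E (suc (suc r))) (suc n)
  ≡⟨ cong₂ _+_ (ballot⋆E s r (suc n))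
               (trans (⋆-x∙ (ballot s) (E (suc (suc r))) n) (ballot⋆E s (suc (suc r)) n)) ⟩
    E (r +ℕ s) (suc n) + E (suc (suc (r +ℕ s))) n
  ≡⟨ E-pascal (r +ℕ s) (suc n) ⟨
    E (suc (r +ℕ s)) (suc n)
  ∎
  where open ≡-Reasoning
ballot⋆E s zero    (suc n) = begin
    (ballot s ⋆ E 0) (suc n)
  ≡⟨ ⋆-congʳ (ballot s) (suc n) E₀≡δ+x∙2E₁ ⟩
    (ballot s ⋆ (λ m → δ m + (x∙ 2E₁) m)) (suc n)
  ≡⟨ ⋆-distribˡ-+ (ballot s) δ (x∙ 2E₁) (suc n) ⟩
    (ballot s ⋆ δ) (suc n) + (ballot s ⋆ x∙ 2E₁) (suc n)
  ≡⟨ cong₂ _+_ (⋆-identityʳ (ballot s) (suc n))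
               (trans (⋆-x∙ (ballot s) 2E₁ n) (⋆-scaleʳ (+ 2) (ballot s) (E 1) n)) ⟩
    ballot s (suc n) + + 2 * (ballot s ⋆ E 1) n
  ≡⟨ cong (λ t → ballot s (suc n) + + 2 * t) (ballot⋆E s 1 n) ⟩
    E s (suc n) - + 2 * E (suc s) n + + 2 * E (suc s) n
  ≡⟨ a-b+b≡a (E s (suc n)) (+ 2 * E (suc s) n) ⟩
    E s (suc n)
  ∎
  where
  open ≡-Reasoning
  2E₁ : ℕ → ℤ
  2E₁ m = + 2 * E 1 m
  a-b+b≡a : ∀ a b → a - b + b ≡ a
  a-b+b≡a = ℤ-Solver.solve-∀

ballot-E : ∀ r n → ballot (suc (suc r)) (suc (suc n)) ≡ E r (suc (suc n)) - E (suc (suc (suc (suc r)))) n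
ballot-E r n = begin
    E (suc (suc r)) (suc (suc n)) - + 2 * E (suc (suc (suc r))) (suc n)
  ≡⟨ cong (_- + 2 * c)
       (trans (E-pascal (suc r) (suc (suc n))) (cong (_+ c) (E-pascal r (suc (suc n))))) ⟩
    x + y + c - + 2 * c
  ≡⟨ cong (λ c → x + y + c - + 2 * c) (E-pascal (suc (suc r)) (suc n)) ⟩
    x + y + (y + z) - + 2 * (y + z)
  ≡⟨ x+y+[y+z]-2[y+z]≡x-z x y z ⟩
    x - z
  ∎
  where
  open ≡-Reasoning
  x = E r (suc (suc n))
  y = E (suc (suc r)) (suc n)
  z = E (suc (suc (suc (suc r)))) n
  c = E (suc (suc (suc r))) (suc n)
  x+y+[y+z]-2[y+z]≡x-z : ∀ x y z → x + y + (y + z) - + 2 * (y + z) ≡ x - z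
  x+y+[y+z]-2[y+z]≡x-z = ℤ-Solver.solve-∀

Γ : ℕ → ℤ
Γ zero          = + 1
Γ (suc zero)    = + 0
Γ (suc (suc n)) = - ballot 4 n

Γ⋆E : ∀ r m → (Γ ⋆ E r) (suc (suc m)) ≡ E r (suc (suc m)) - E (r +ℕ 4) m
Γ⋆E r m = begin
    (Γ ⋆ E r) (suc (suc m))
  ≡⟨⟩
    + 1 * E r (suc (suc m)) + (+ 0 * E r (suc m) + ((λ i → - ballot 4 i) ⋆ E r) m)
  ≡⟨ cong (λ t → + 1 * E r (suc (suc m)) + (+ 0 * E r (suc m) + t))
       (trans (⋆-negˡ (ballot 4) (E r) m) (cong -_ (ballot⋆E 4 r m))) ⟩
    + 1 * E r (suc (suc m)) + (+ 0 * E r (suc m) + - E (r +ℕ 4) m)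
  ≡⟨ 1a+[0b+-c]≡a-c (E r (suc (suc m))) (E r (suc m)) (E (r +ℕ 4) m) ⟩
    E r (suc (suc m)) - E (r +ℕ 4) m
  ∎
  where
  open ≡-Reasoning
  1a+[0b+-c]≡a-c : ∀ a b c → + 1 * a + (+ 0 * b + - c) ≡ a - c
  1a+[0b+-c]≡a-c = ℤ-Solver.solve-∀

Γ⋆E₂ : ∀ m → (Γ ⋆ E 2) m ≡ ballot 4 m
Γ⋆E₂ zero          = refl
Γ⋆E₂ (suc zero)    = refl
Γ⋆E₂ (suc (suc m)) = trans (Γ⋆E 2 m) (sym (ballot-E 2 m))

recursionSum : (ℕ → ℤ) → ℕ → ℤ
recursionSum g n = ∑[< n ] (λ j → g j * κ (n ∸ j))

recursionSum-cong : ∀ {f g} n → (∀ j → j < n → f j ≡ g j) → recursionSum f n ≡ recursionSum g n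
recursionSum-cong n eq = ∑[<]-cong n (λ j j<n → cong (_* κ (n ∸ j)) (eq j j<n))

recursionSum≡⋆κ : ∀ g n → recursionSum g n ≡ (g ⋆ κ) n
recursionSum≡⋆κ g n = sym (begin
    (g ⋆ κ) n
  ≡⟨ ∑[<]-snoc n (λ j → g j * κ (n ∸ j)) ⟩
    recursionSum g n + g n * κ (n ∸ n)
  ≡⟨ cong (λ t → recursionSum g n + g n * κ t) (ℕ.n∸n≡0 n) ⟩
    recursionSum g n + g n * + 0
  ≡⟨ cong (_+_ (recursionSum g n)) (ℤ.*-zeroʳ (g n)) ⟩
    recursionSum g n + + 0
  ≡⟨ ℤ.+-identityʳ _ ⟩
    recursionSum g n
  ∎)
  where open ≡-Reasoning

recursionSum-Γ : ∀ n → recursionSum Γ n ≡ - Γ (suc n)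
recursionSum-Γ zero    = refl
recursionSum-Γ (suc n) = begin
    recursionSum Γ (suc n)
  ≡⟨ recursionSum≡⋆κ Γ (suc n) ⟩
    (Γ ⋆ κ) (suc n)
  ≡⟨ ⋆-congʳ Γ (suc n) κ≡x∙E₂ ⟩
    (Γ ⋆ x∙ E 2) (suc n)
  ≡⟨ ⋆-x∙ Γ (E 2) n ⟩
    (Γ ⋆ E 2) n
  ≡⟨ Γ⋆E₂ n ⟩
    ballot 4 n
  ≡⟨ ℤ.neg-involutive (ballot 4 n) ⟨
    - Γ (suc (suc n))
  ∎
  where open ≡-Reasoning

[1+k]*[1+n]C[1+k]≡[1+n]*nCk : ∀ n k → suc k *ℕ (suc n C suc k) ≡ suc n *ℕ (n C k)
[1+k]*[1+n]C[1+k]≡[1+n]*nCk zero    zero    = refl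
[1+k]*[1+n]C[1+k]≡[1+n]*nCk zero    (suc k) = ℕ.*-zeroʳ (suc (suc k))
[1+k]*[1+n]C[1+k]≡[1+n]*nCk (suc n) zero    =
  trans (ℕ.*-identityˡ _) (trans (nC1≡n (suc (suc n))) (sym (ℕ.*-identityʳ _)))
[1+k]*[1+n]C[1+k]≡[1+n]*nCk (suc n) (suc k) = begin
    suc (suc k) *ℕ (suc (suc n) C suc (suc k))
  ≡⟨ cong (suc (suc k) *ℕ_) (nCk+nC[k+1]≡[n+1]C[k+1] (suc n) (suc k)) ⟨
    suc (suc k) *ℕ (R +ℕ T)
  ≡⟨ distrib k R T ⟩
    R +ℕ suc k *ℕ R +ℕ suc (suc k) *ℕ T
  ≡⟨ cong₂ (λ a b → R +ℕ a +ℕ b)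
       ([1+k]*[1+n]C[1+k]≡[1+n]*nCk n k) ([1+k]*[1+n]C[1+k]≡[1+n]*nCk n (suc k)) ⟩
    R +ℕ suc n *ℕ (n C k) +ℕ suc n *ℕ (n C suc k)
  ≡⟨ ℕ.+-assoc R _ _ ⟩
    R +ℕ (suc n *ℕ (n C k) +ℕ suc n *ℕ (n C suc k))
  ≡⟨ cong (R +ℕ_) (ℕ.*-distribˡ-+ (suc n) (n C k) (n C suc k)) ⟨
    R +ℕ suc n *ℕ (n C k +ℕ n C suc k)
  ≡⟨ cong (λ a → R +ℕ suc n *ℕ a) (nCk+nC[k+1]≡[n+1]C[k+1] n k) ⟩
    R +ℕ suc n *ℕ R
  ∎
  where
  open ≡-Reasoning
  R = suc n C suc k
  T = suc n C suc (suc k)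
  distrib : ∀ k R T → (2 +ℕ k) *ℕ (R +ℕ T) ≡ R +ℕ (1 +ℕ k) *ℕ R +ℕ (2 +ℕ k) *ℕ T
  distrib = ℕ-Solver.solve-∀

[2+m]*C[2+2m,2+m]≡[1+m]*C[2+2m,1+m] : ∀ m →
  suc (suc m) *ℕ (suc (suc (2 *ℕ m)) C suc (suc m)) ≡ suc m *ℕ (suc (suc (2 *ℕ m)) C suc m)
[2+m]*C[2+2m,2+m]≡[1+m]*C[2+2m,1+m] m = begin
    suc (suc m) *ℕ (suc M C suc (suc m))
  ≡⟨ [1+k]*[1+n]C[1+k]≡[1+n]*nCk M (suc m) ⟩
    suc M *ℕ (M C suc m)
  ≡⟨ cong (suc M *ℕ_) (C-sym (suc m) m (1+m+m≡1+2m m)) ⟩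
    suc M *ℕ (M C m)
  ≡⟨ [1+k]*[1+n]C[1+k]≡[1+n]*nCk M m ⟨
    suc m *ℕ (suc M C suc m)
  ∎
  where
  open ≡-Reasoning
  M = suc (2 *ℕ m)
  1+m+m≡1+2m : ∀ m → suc m +ℕ m ≡ suc (2 *ℕ m)
  1+m+m≡1+2m = ℕ-Solver.solve-∀

-- From (1+d) q = d p we get p = (1+d)(p - q), so the division is exact.
[1+d]*q≡d*p⇒p/[1+d]≡p-q : ∀ d p q → suc d *ℕ q ≡ d *ℕ p → + (p / suc d) ≡ + p - + q
[1+d]*q≡d*p⇒p/[1+d]≡p-q d p q eq = begin
    + (p / suc d)
  ≡⟨ cong (λ t → + (t / suc d)) [p∸q]*[1+d]≡p ⟨
    + ((p ∸ q) *ℕ suc d / suc d)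
  ≡⟨ cong +_ (m*n/n≡m (p ∸ q) (suc d)) ⟩
    + (p ∸ q)
  ≡⟨ ℤ.⊖-≥ q≤p ⟨
    p ⊖ q
  ≡⟨ ℤ.[+m]-[+n]≡m⊖n p q ⟨
    + p - + q
  ∎
  where
  open ≡-Reasoning
  q≤p : q ≤ p
  q≤p = ℕ.*-cancelˡ-≤ (suc d) (ℕ.≤-trans (ℕ.≤-reflexive eq) (ℕ.m≤n+m (d *ℕ p) p))
  [p∸q]*[1+d]≡p : (p ∸ q) *ℕ suc d ≡ p
  [p∸q]*[1+d]≡p = begin
      (p ∸ q) *ℕ suc d
    ≡⟨ ℕ.*-comm (p ∸ q) (suc d) ⟩
      suc d *ℕ (p ∸ q)
    ≡⟨ ℕ.*-distribˡ-∸ (suc d) p q ⟩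
      suc d *ℕ p ∸ suc d *ℕ q
    ≡⟨ cong (suc d *ℕ p ∸_) eq ⟩
      p +ℕ d *ℕ p ∸ d *ℕ p
    ≡⟨ ℕ.m+n∸n≡m p (d *ℕ p) ⟩
      p
    ∎

catalan-suc : ∀ m → + catalan (suc m) ≡ E 0 (suc m) - E 2 m
catalan-suc m = begin
    + catalan (suc m)
  ≡⟨ cong (λ N → + ((N C suc m) / suc (suc m))) (r+2[1+n]≡2+r+2n 0 m) ⟩
    + ((M C suc m) / suc (suc m))
  ≡⟨ [1+d]*q≡d*p⇒p/[1+d]≡p-q (suc m) (M C suc m) (M C suc (suc m))
       ([2+m]*C[2+2m,2+m]≡[1+m]*C[2+2m,1+m] m) ⟩
    + (M C suc m) - + (M C suc (suc m))
  ≡⟨ cong (λ N → + (N C suc m) - + (N C suc (suc m))) (r+2[1+n]≡2+r+2n 0 m) ⟨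
    E 0 (suc m) - κ (suc m)
  ≡⟨ cong (_-_ (E 0 (suc m))) (κ≡x∙E₂ (suc m)) ⟩
    E 0 (suc m) - E 2 m
  ∎
  where
  open ≡-Reasoning
  M = suc (suc (2 *ℕ m))

catalan≡E₀-E₄ : ∀ p → + catalan (suc (suc (suc p))) ≡ E 0 (suc (suc p)) - E 4 p
catalan≡E₀-E₄ p = begin
    + catalan (suc (suc (suc p)))
  ≡⟨ catalan-suc (suc (suc p)) ⟩
    E 0 (suc (suc (suc p))) - E 2 (suc (suc p))
  ≡⟨ cong₂ _-_ (trans (E₀-suc (suc (suc p))) (cong (+ 2 *_) (E-pascal 0 (suc (suc p)))))
               (trans (E-pascal 1 (suc (suc p)))
                      (cong₂ _+_ (E-pascal 0 (suc (suc p))) (E-pascal 2 (suc p)))) ⟩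
    + 2 * (x + y) - (x + y + (y + z))
  ≡⟨ 2[x+y]-[x+y+[y+z]]≡x-z x y z ⟩
    x - z
  ∎
  where
  open ≡-Reasoning
  x = E 0 (suc (suc p))
  y = E 2 (suc p)
  z = E 4 p
  2[x+y]-[x+y+[y+z]]≡x-z : ∀ x y z → + 2 * (x + y) - (x + y + (y + z)) ≡ x - z
  2[x+y]-[x+y+[y+z]]≡x-z = ℤ-Solver.solve-∀

n+1∸j≡1+[n∸j] : ∀ {n j} → j ≤ n → n +ℕ 1 ∸ j ≡ suc (n ∸ j)
n+1∸j≡1+[n∸j] {n} {j} j≤n = trans (cong (_∸ j) (ℕ.+-comm n 1)) (ℕ.+-∸-assoc 1 j≤n)

∑[1to]-recursionSum : ∀ n (g : ℕ → ℤ) →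
  ∑[ 1 to n ] (λ i → binom (2 *ℕ (suc (suc n) ∸ i ∸ 1)) (suc (suc n) ∸ i) * g i)
    ≡ recursionSum (g ∘ suc) n
∑[1to]-recursionSum n g = trans (∑[1to]≡∑[<] n term) (∑[<]-cong n reindex)
  where
  term : ℕ → ℤ
  term i = binom (2 *ℕ (suc (suc n) ∸ i ∸ 1)) (suc (suc n) ∸ i) * g i
  reindex : ∀ j → j < n → term (suc j) ≡ g (suc j) * κ (n ∸ j)
  reindex j j<n = trans (cong (λ t → binom (2 *ℕ (t ∸ 1)) t * g (suc j)) (ℕ.+-∸-assoc 1 (ℕ.<⇒≤ j<n)))
                        (ℤ.*-comm (κ (n ∸ j)) (g (suc j)))

∑[1to]-recursionSum′ : ∀ n (g : ℕ → ℤ) →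
  ∑[ 1 to n ] (λ i → binom (2 *ℕ (suc n ∸ i)) (suc n +ℕ 1 ∸ i) * g i)
    ≡ recursionSum (g ∘ suc) n
∑[1to]-recursionSum′ n g = trans (∑[1to]≡∑[<] n term) (∑[<]-cong n reindex)
  where
  term : ℕ → ℤ
  term i = binom (2 *ℕ (suc n ∸ i)) (suc n +ℕ 1 ∸ i) * g i
  reindex : ∀ j → j < n → term (suc j) ≡ g (suc j) * κ (n ∸ j)
  reindex j j<n = trans (cong (λ t → binom (2 *ℕ (n ∸ j)) t * g (suc j)) (n+1∸j≡1+[n∸j] (ℕ.<⇒≤ j<n)))
                        (ℤ.*-comm (κ (n ∸ j)) (g (suc j)))

∑[1to]-⋆E₀ : ∀ p (g : ℕ → ℤ) →
  ∑[ 1 to suc p ] (λ i → binom (2 *ℕ (suc (suc p) ∸ i +ℕ 1)) (suc (suc p) +ℕ 1 ∸ i) * g i)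
    ≡ (g ∘ suc ⋆ (λ m → E 0 (suc (suc m)))) p
∑[1to]-⋆E₀ p g = trans (∑[1to]≡∑[<] (suc p) term) (∑[<]-cong (suc p) reindex)
  where
  term : ℕ → ℤ
  term i = binom (2 *ℕ (suc (suc p) ∸ i +ℕ 1)) (suc (suc p) +ℕ 1 ∸ i) * g i
  reindex : ∀ j → j < suc p → term (suc j) ≡ g (suc j) * E 0 (suc (suc (p ∸ j)))
  reindex j j<1+p = trans (cong₂ (λ a b → binom (2 *ℕ a) b * g (suc j))
      (trans (ℕ.+-comm (suc p ∸ j) 1) (cong suc (ℕ.+-∸-assoc 1 j≤p)))
      (trans (n+1∸j≡1+[n∸j] (ℕ.m≤n⇒m≤1+n j≤p)) (cong suc (ℕ.+-∸-assoc 1 j≤p))))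
    (ℤ.*-comm (E 0 (suc (suc (p ∸ j)))) (g (suc j)))
    where j≤p = s≤s⁻¹ j<1+p

Γ⋆E₀≡recursionSums : ∀ p → (Γ ⋆ E 0) (suc (suc p))
  ≡ (Γ ⋆ (λ m → E 0 (suc (suc m)))) p - recursionSum Γ (suc p) - + 2 * recursionSum Γ p
Γ⋆E₀≡recursionSums p = begin
    (Γ ⋆ E 0) (suc (suc p))
  ≡⟨ ⋆-snoc Γ (E 0) (suc p) ⟩
    (Γ ⋆ E 0 ∘ suc) (suc p) + Γ (suc (suc p)) * + 1
  ≡⟨ cong (_+ Γ (suc (suc p)) * + 1) (⋆-snoc Γ (E 0 ∘ suc) p) ⟩
    c + Γ (suc p) * + 2 + Γ (suc (suc p)) * + 1
  ≡⟨ rearrange c (Γ (suc p)) (Γ (suc (suc p))) ⟩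
    c - - Γ (suc (suc p)) - + 2 * - Γ (suc p)
  ≡⟨ cong₂ (λ a b → c - a - + 2 * b) (recursionSum-Γ (suc p)) (recursionSum-Γ p) ⟨
    c - recursionSum Γ (suc p) - + 2 * recursionSum Γ p
  ∎
  where
  open ≡-Reasoning
  c = (Γ ⋆ (λ m → E 0 (suc (suc m)))) p
  rearrange : ∀ c a b → c + a * + 2 + b * + 1 ≡ c - - b - + 2 * - a
  rearrange = ℤ-Solver.solve-∀

module _ (k : ℕ) (γ : ℕ → ℤ) (γ₁ : γ 1 ≡ + 1)
  (H : ∀ i → 2 ≤ i → i ≤ k → γ i ≡ - ∑[ 1 to i ∸ 2 ] (λ j → binom (2 *ℕ (i ∸ j ∸ 1)) (i ∸ j) * γ j))
  where

  private
    γ≡Γ-step : ∀ j → suc j ≤ k → (∀ i → i < j → γ (suc i) ≡ Γ i) → γ (suc j) ≡ Γ j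
    γ≡Γ-step zero    _      _     = γ₁
    γ≡Γ-step (suc j) 2+j≤k below = begin
        γ (suc (suc j))
      ≡⟨ H (suc (suc j)) (s≤s (s≤s z≤n)) 2+j≤k ⟩
        - ∑[ 1 to j ] (λ i → binom (2 *ℕ (suc (suc j) ∸ i ∸ 1)) (suc (suc j) ∸ i) * γ i)
      ≡⟨ cong -_ (∑[1to]-recursionSum j γ) ⟩
        - recursionSum (γ ∘ suc) j
      ≡⟨ cong -_ (recursionSum-cong j (λ i i<j → below i (ℕ.m<n⇒m<1+n i<j))) ⟩
        - recursionSum Γ j
      ≡⟨ cong -_ (recursionSum-Γ j) ⟩
        - - Γ (suc j)
      ≡⟨ ℤ.neg-involutive (Γ (suc j)) ⟩
        Γ (suc j)
      ∎
      where open ≡-Reasoning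

    γ≡Γ-below : ∀ n → n ≤ k → ∀ j → j < n → γ (suc j) ≡ Γ j
    γ≡Γ-below (suc n) 1+n≤k j j<1+n with ℕ.m≤n⇒m<n∨m≡n (s≤s⁻¹ j<1+n)
    ... | inj₁ j<n  = γ≡Γ-below n (ℕ.<⇒≤ 1+n≤k) j j<n
    ... | inj₂ refl = γ≡Γ-step j 1+n≤k (γ≡Γ-below j (ℕ.<⇒≤ 1+n≤k))

  γ≡Γ : ∀ j → j < k → γ (suc j) ≡ Γ j
  γ≡Γ = γ≡Γ-below k ℕ.≤-refl

corollary3p5 : (k : ℕ) → 2 ≤ k → (γ : ℕ → ℤ) → γ 1 ≡ + 1
    → (∀ i → 2 ≤ i → i ≤ k → γ i ≡ - ∑[ 1 to i ∸ 2 ] (λ j → binom (2 *ℕ (i ∸ j ∸ 1)) (i ∸ j) * γ j))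
    → + catalan (k +ℕ 1)
      ≡ ∑[ 1 to k ∸ 1 ] (λ i → binom (2 *ℕ (k ∸ i +ℕ 1)) (k +ℕ 1 ∸ i) * γ i)
        - ∑[ 1 to k ∸ 1 ] (λ i → binom (2 *ℕ (k ∸ i)) (k +ℕ 1 ∸ i) * γ i)
        - ∑[ 1 to k ∸ 2 ] (λ i → + 2 * binom (2 *ℕ (k ∸ i ∸ 1)) (k ∸ i) * γ i)
corollary3p5 (suc zero)    (s≤s ()) _ _ _
corollary3p5 (suc (suc p)) _ γ γ₁ H = begin
    + catalan (suc (suc p) +ℕ 1)
  ≡⟨ cong (λ m → + catalan m) (ℕ.+-comm (suc (suc p)) 1) ⟩
    + catalan (suc (suc (suc p)))
  ≡⟨ catalan≡E₀-E₄ p ⟩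
    E 0 (suc (suc p)) - E 4 p
  ≡⟨ Γ⋆E 0 p ⟨
    (Γ ⋆ E 0) (suc (suc p))
  ≡⟨ Γ⋆E₀≡recursionSums p ⟩
    (Γ ⋆ (λ m → E 0 (suc (suc m)))) p - recursionSum Γ (suc p) - + 2 * recursionSum Γ p
  ≡⟨ cong₂ _-_ (cong₂ _-_ first second) third ⟨
      ∑[ 1 to suc p ] (λ i → binom (2 *ℕ (k ∸ i +ℕ 1)) (k +ℕ 1 ∸ i) * γ i)
    - ∑[ 1 to suc p ] (λ i → binom (2 *ℕ (k ∸ i)) (k +ℕ 1 ∸ i) * γ i)
    - ∑[ 1 to p ] (λ i → + 2 * binom (2 *ℕ (k ∸ i ∸ 1)) (k ∸ i) * γ i)
  ∎
  where
  open ≡-Reasoning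
  k = suc (suc p)
  agree : ∀ j → j < suc p → γ (suc j) ≡ Γ j
  agree j j<1+p = γ≡Γ k γ γ₁ H j (ℕ.m<n⇒m<1+n j<1+p)
  first : ∑[ 1 to suc p ] (λ i → binom (2 *ℕ (k ∸ i +ℕ 1)) (k +ℕ 1 ∸ i) * γ i)
        ≡ (Γ ⋆ (λ m → E 0 (suc (suc m)))) p
  first = trans (∑[1to]-⋆E₀ p γ) (⋆-congˡ (λ m → E 0 (suc (suc m))) p agree)
  second : ∑[ 1 to suc p ] (λ i → binom (2 *ℕ (k ∸ i)) (k +ℕ 1 ∸ i) * γ i) ≡ recursionSum Γ (suc p)
  second = trans (∑[1to]-recursionSum′ (suc p) γ) (recursionSum-cong (suc p) agree)
  third : ∑[ 1 to p ] (λ i → + 2 * binom (2 *ℕ (k ∸ i ∸ 1)) (k ∸ i) * γ i) ≡ + 2 * recursionSum Γ p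
  third = trans (∑[1to]-*ˡ p (+ 2) (λ i → binom (2 *ℕ (k ∸ i ∸ 1)) (k ∸ i)) γ)
                (cong (+ 2 *_) (trans (∑[1to]-recursionSum p γ)
                                      (recursionSum-cong p (λ j j<p → agree j (ℕ.m<n⇒m<1+n j<p)))))
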